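{- For any single round robin schedule of $n$ teams, its ranking fairness $F$ satisfies $F=0$ if and only if the schedule is ranking-fair.
   Context: Teams are $T=\{1,\dots,n\}$ ($n\ge 4$ even), ranked by strength: team $i$ is stronger than team $j$ iff $i<j$. A schedule assigns to each unordered pair of distinct teams a round in $\{1,\dots,n-1\}$ and designates which team plays at home. The ranking HAP of team $t$ is the vector $(p_1,\dots,p_{n-1})$, $p_m\in\{H,A\}$ indicating whether $t$ plays home or away against its $m$-th strongest opponent. A schedule is ranking-fair if every team's ranking HAP alternates between $H$ and $A$. For $1\le i<j\le n-1$ let $H^t_{i,j}$ be the number of entries equal to $H$ among $p_i,\dots,p_j$ of team $t$'s ranking HAP. Define $\Delta_t=\sum_{i=1}^{n-2}\sum_{j=i+1}^{n-1}\left|H^t_{i,j}-\frac{j-i+1}{2}\right|$, $F_t=\dfrac{\Delta_t-\frac18(n-2)^2}{\frac1{24}n(n-1)(n-2)}$, and the ranking fairness of the schedule $F=\frac1n\sum_{t\in T}F_t$. -}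

module Defs where

open import Data.Nat using (ℕ; zero; suc; _+_; _*_; _∸_; _^_)
open import Data.Bool using (Bool; true; false; not)
open import Data.Fin using (Fin)
import Data.Fin as Fin
open import Data.List using (List; []; _∷_; map; filter; foldr; allFin; applyUpTo; take; drop)
open import Data.Integer using (+_)
open import Data.Rational using (ℚ; 0ℚ; _/_; ∣_∣)
import Data.Rational as Q
open import Data.Unit using (⊤)
open import Data.Product using (_×_)
open import Relation.Nullary using (¬?)
open import Relation.Binary.PropositionalEquality using (_≡_; _≢_)

-- A single round robin schedule on teams Fin n (team 0 = strongest, i.e. team i+1
-- of the paper is Fin index i). Rounds {1..n-1} are represented by Fin (n ∸ 1).
-- home s t = true means: in the game between s and t, team s plays at home.
-- Values on the diagonal (s = t) are irrelevant.
record Schedule (n : ℕ) : Set where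
  field
    round         : Fin n → Fin n → Fin (n ∸ 1)
    home          : Fin n → Fin n → Bool
    round-sym     : ∀ s t → s ≢ t → round s t ≡ round t s
    home-anti     : ∀ s t → s ≢ t → home s t ≡ not (home t s)
    -- each team plays at most (hence, by counting, exactly) one game per round
    one-per-round : ∀ t s s' → s ≢ t → s' ≢ t → round t s ≡ round t s' → s ≡ s'

open Schedule public

opponents : {n : ℕ} → Fin n → List (Fin n)
opponents {n} t = filter (λ s → ¬? (s Fin.≟ t)) (allFin n)

-- ranking HAP of t: true = H, false = A
rankingHAP : {n : ℕ} → Schedule n → Fin n → List Bool
rankingHAP S t = map (home S t) (opponents t)

Alternating : List Bool → Set
Alternating []            = ⊤
Alternating (x ∷ [])      = ⊤
Alternating (x ∷ y ∷ r)   = (x ≡ not y) × Alternating (y ∷ r)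

RankingFair : {n : ℕ} → Schedule n → Set
RankingFair {n} S = (t : Fin n) → Alternating (rankingHAP S t)

countH : List Bool → ℕ
countH []           = 0
countH (true ∷ r)   = suc (countH r)
countH (false ∷ r)  = countH r

-- H_{i,j} (1-based positions, i ≤ j): number of H among p_i,…,p_j
Hij : List Bool → ℕ → ℕ → ℕ
Hij p i j = countH (take (suc (j ∸ i)) (drop (i ∸ 1) p))

-- [a, a+1, …, b]  (empty if b < a)
range : ℕ → ℕ → List ℕ
range a b = applyUpTo (λ k → a + k) (suc b ∸ a)

sumℚ : List ℚ → ℚ
sumℚ = foldr Q._+_ 0ℚ

Delta : ℕ → List Bool → ℚ
Delta n p =
  sumℚ (map (λ i → sumℚ (map (λ j →
      ∣ (+ Hij p i j / 1) Q.- (+ (suc (j ∸ i)) / 2) ∣)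
    (range (suc i) (n ∸ 1))))
  (range 1 (n ∸ 2)))

-- 1/k for k ≠ 0 (and 0 for k = 0; only used with k > 0 below since n ≥ 4)
inv : ℕ → ℚ
inv zero    = 0ℚ
inv (suc k) = + 1 / suc k

Fteam : {n : ℕ} → Schedule n → Fin n → ℚ
Fteam {n} S t =
  ((Delta n (rankingHAP S t) Q.- (+ ((n ∸ 2) ^ 2) / 8)) Q.* (+ 24 / 1))
    Q.* inv (n * (n ∸ 1) * (n ∸ 2))

rankingFairness : {n : ℕ} → Schedule n → ℚ
rankingFairness {n} S = sumℚ (map (Fteam S) (allFin n)) Q.* inv n

{-# OPTIONS --safe #-}
module Submission where

-- For a window p_i … p_j of length L = j − i + 1, |H_{i,j} − L/2| = |2H_{i,j} − L|/2, and since
-- 2H_{i,j} − L ≡ L (mod 2) this is at least (L mod 2)/2, with equality for every window of an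
-- alternating HAP. For n = 2 + 2m these parity bounds add up to m²/2 = (n−2)²/8, so Δ_t − (n−2)²/8
-- is half the natural-number excess of team t over the bound, and F is a positive multiple of the
-- total excess. Hence F = 0 iff every window of every HAP attains its bound; alternating HAPs do,
-- and conversely the windows of length 2 force consecutive entries to differ.

open import Defs
open import Data.Nat using (ℕ; _≤_)
open import Data.Nat.Divisibility using (_∣_)
open import Data.Rational using (0ℚ)
open import Relation.Binary.PropositionalEquality using (_≡_)
open import Function.Bundles using (_⇔_)

open import Data.Bool using (Bool; true; false; not)
open import Data.Empty using (⊥-elim)
open import Data.Fin as Fin using (Fin)
open import Data.Integer as ℤ using (+_; _⊖_)
import Data.Integer.Properties as ℤ
import Data.Integer.Tactic.RingSolver as ℤ-Solver
open import Data.List using (List; []; _∷_; length; take; drop; map; filter; applyUpTo; allFin)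
open import Data.List.Properties
  using (length-take; length-drop; length-map; length-tabulate; map-applyUpTo; map-cong; map-cong-local;
         filter-accept; filter-reject; filter-all)
open import Data.List.Membership.Propositional using (_∈_)
open import Data.List.Membership.Propositional.Properties using (∈-applyUpTo⁺; ∈-applyUpTo⁻; ∈-allFin)
open import Data.List.Relation.Unary.All as All using (All)
open import Data.List.Relation.Unary.Any using (here; there)
open import Data.List.Relation.Unary.Unique.Propositional using (Unique; _∷_)
open import Data.List.Relation.Unary.Unique.Propositional.Properties using (allFin⁺)
open import Data.Nat using (zero; suc; _+_; _*_; _∸_; _^_; _<_; _⊓_; z≤n; s≤s; s≤s⁻¹; NonZero; ∣_-_∣; ⌊_/2⌋)
open import Data.Nat.DivMod using (_%_; m%n≤m)
open import Data.Nat.Divisibility using (divides)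
open import Data.Nat.ListAction using (sum)
open import Data.Nat.Properties
import Data.Nat.Tactic.RingSolver as ℕ-Solver
open import Data.Product using (∃; _×_; _,_; proj₁; proj₂)
open import Data.Rational as ℚ using (ℚ; _/_; toℚᵘ; Positive)
import Data.Rational.Properties as ℚ
open import Algebra.Properties.AbelianGroup ℚ.+-0-abelianGroup using (xyx⁻¹≈y)
open import Data.Rational.Unnormalised as ℚᵘ using (mkℚᵘ; *≡*)
import Data.Rational.Unnormalised.Properties as ℚᵘ
open import Data.Unit using (tt)
open import Function using (id; _∘_; mk⇔; Equivalence)
open import Relation.Binary.Definitions using (DecidableEquality)
open import Relation.Binary.PropositionalEquality using (refl; sym; trans; cong; cong₂; subst; module ≡-Reasoning)
open import Relation.Nullary using (¬?)


%2≤∣h+h-m∣ : ∀ h m → m % 2 ≤ ∣ h + h - m ∣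
%2≤∣h+h-m∣ h       zero          = z≤n
%2≤∣h+h-m∣ zero    (suc m)       = m%n≤m (suc m) 2
%2≤∣h+h-m∣ (suc h) (suc zero)    rewrite +-suc h h = s≤s z≤n
%2≤∣h+h-m∣ (suc h) (suc (suc m)) rewrite +-suc h h = %2≤∣h+h-m∣ h m

Alternating-tail : ∀ {x} xs → Alternating (x ∷ xs) → Alternating xs
Alternating-tail []      _       = tt
Alternating-tail (_ ∷ _) (_ , a) = a

Alternating-drop : ∀ k xs → Alternating xs → Alternating (drop k xs)
Alternating-drop zero    xs       a = a
Alternating-drop (suc k) []       a = tt
Alternating-drop (suc k) (x ∷ xs) a = Alternating-drop k xs (Alternating-tail xs a)

Alternating-take : ∀ k xs → Alternating xs → Alternating (take k xs)
Alternating-take zero          xs           _       = tt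
Alternating-take (suc k)       []           _       = tt
Alternating-take (suc zero)    (x ∷ xs)     _       = tt
Alternating-take (suc (suc k)) (x ∷ [])     _       = tt
Alternating-take (suc (suc k)) (x ∷ y ∷ xs) (e , a) = e , Alternating-take (suc k) (y ∷ xs) a

Alternating⇒∣2countH-length∣≡length%2 : ∀ xs → Alternating xs →
  ∣ countH xs + countH xs - length xs ∣ ≡ length xs % 2
Alternating⇒∣2countH-length∣≡length%2 []                   _       = refl
Alternating⇒∣2countH-length∣≡length%2 (true ∷ [])          _       = refl
Alternating⇒∣2countH-length∣≡length%2 (false ∷ [])         _       = refl
Alternating⇒∣2countH-length∣≡length%2 (true ∷ false ∷ xs)  (_ , a)
  rewrite +-suc (countH xs) (countH xs) = Alternating⇒∣2countH-length∣≡length%2 xs (Alternating-tail xs a)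
Alternating⇒∣2countH-length∣≡length%2 (false ∷ true ∷ xs)  (_ , a)
  rewrite +-suc (countH xs) (countH xs) = Alternating⇒∣2countH-length∣≡length%2 xs (Alternating-tail xs a)

Alternating-fromPairs : ∀ xs →
  (∀ k → 2 + k ≤ length xs → countH (take 2 (drop k xs)) + countH (take 2 (drop k xs)) ≡ 2) →
  Alternating xs
Alternating-fromPairs []           _        = tt
Alternating-fromPairs (x ∷ [])     _        = tt
Alternating-fromPairs (x ∷ y ∷ xs) balanced =
  alternatingPair x y (balanced 0 (s≤s (s≤s z≤n))) ,
  Alternating-fromPairs (y ∷ xs) (λ k le → balanced (suc k) (s≤s le))
  where
  alternatingPair : ∀ x y → countH (x ∷ y ∷ []) + countH (x ∷ y ∷ []) ≡ 2 → x ≡ not y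
  alternatingPair true  false _ = refl
  alternatingPair false true  _ = refl

window : List Bool → ℕ → ℕ → List Bool
window p i j = take (suc (j ∸ i)) (drop (i ∸ 1) p)

length-take-drop : ∀ {A : Set} k l (xs : List A) → k + l ≤ length xs → length (take l (drop k xs)) ≡ l
length-take-drop k l xs k+l≤len = begin
  length (take l (drop k xs))   ≡⟨ length-take l (drop k xs) ⟩
  l ⊓ length (drop k xs)        ≡⟨ cong (l ⊓_) (length-drop k xs) ⟩
  l ⊓ (length xs ∸ k)           ≡⟨ m≤n⇒m⊓n≡m (m+n≤o⇒m≤o∸n l (subst (_≤ length xs) (+-comm k l) k+l≤len)) ⟩
  l                             ∎
  where open ≡-Reasoning

length-window : ∀ p {i j} → 1 ≤ i → i ≤ j → j ≤ length p → length (window p i j) ≡ suc (j ∸ i)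
length-window p {suc i} {suc j} _ (s≤s i≤j) 1+j≤len =
  length-take-drop i (suc (j ∸ i)) p (subst (_≤ length p) 1+j≡i+[1+j∸i] 1+j≤len)
  where
  1+j≡i+[1+j∸i] : suc j ≡ i + suc (j ∸ i)
  1+j≡i+[1+j∸i] = sym (trans (+-suc i (j ∸ i)) (cong suc (m+[n∸m]≡n i≤j)))

∈-range⁺ : ∀ {a b k} → a ≤ k → k ≤ b → k ∈ range a b
∈-range⁺ {a} {b} a≤k k≤b =
  subst (_∈ range a b) (m+[n∸m]≡n a≤k) (∈-applyUpTo⁺ (λ k → a + k) (∸-monoˡ-< (s≤s k≤b) a≤k))

∈-range⁻ : ∀ {a b k} → k ∈ range a b → a ≤ k × k ≤ b
∈-range⁻ {a} {b} k∈ with ∈-applyUpTo⁻ (λ k → a + k) k∈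
... | i , i<1+b∸a , refl = m≤m+n a i , a+i≤b
  where
  a≤1+b : a ≤ suc b
  a≤1+b = <⇒≤ (m∸n≢0⇒n<m (λ eq → n≮0 (subst (i <_) eq i<1+b∸a)))
  a+i≤b : a + i ≤ b
  a+i≤b = s≤s⁻¹ (subst (_≤ suc b) (cong suc (+-comm i a)) (m≤o∸n⇒m+n≤o (suc i) a≤1+b i<1+b∸a))

module _ {A : Set} {f g : A → ℕ} where

  sum-map-mono : (∀ x → f x ≤ g x) → ∀ xs → sum (map f xs) ≤ sum (map g xs)
  sum-map-mono f≤g []       = z≤n
  sum-map-mono f≤g (x ∷ xs) = +-mono-≤ (f≤g x) (sum-map-mono f≤g xs)

  sum-map-mono-< : (∀ x → f x ≤ g x) → ∀ {x xs} → x ∈ xs → f x < g x → sum (map f xs) < sum (map g xs)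
  sum-map-mono-< f≤g {xs = y ∷ ys} (here refl) fx<gx = +-mono-<-≤ fx<gx (sum-map-mono f≤g ys)
  sum-map-mono-< f≤g {xs = y ∷ ys} (there x∈) fx<gx = +-mono-≤-< (f≤g y) (sum-map-mono-< f≤g x∈ fx<gx)

  sum-map-≡⇒ : (∀ x → f x ≤ g x) → ∀ {xs} → sum (map f xs) ≡ sum (map g xs) → ∀ {x} → x ∈ xs → f x ≡ g x
  sum-map-≡⇒ f≤g eq x∈ = ≤-antisym (f≤g _) (≮⇒≥ (λ fx<gx → <-irrefl eq (sum-map-mono-< f≤g x∈ fx<gx)))

  sum-map-cong : ∀ {xs} → (∀ {x} → x ∈ xs → f x ≡ g x) → sum (map f xs) ≡ sum (map g xs)
  sum-map-cong f≡g = cong sum (map-cong-local (All.tabulate f≡g))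

module _ {A : Set} (f : A → ℕ) where

  sum-map-≡0⇒ : ∀ {xs} → sum (map f xs) ≡ 0 → ∀ {x} → x ∈ xs → f x ≡ 0
  sum-map-≡0⇒ {y ∷ _} eq (here refl) = m+n≡0⇒m≡0 (f y) eq
  sum-map-≡0⇒ {y ∷ _} eq (there x∈)  = sum-map-≡0⇒ (m+n≡0⇒n≡0 (f y) eq) x∈

  sum-map-≡0⇐ : ∀ xs → (∀ {x} → x ∈ xs → f x ≡ 0) → sum (map f xs) ≡ 0
  sum-map-≡0⇐ []       _   = refl
  sum-map-≡0⇐ (x ∷ xs) f≡0 = cong₂ _+_ (f≡0 (here refl)) (sum-map-≡0⇐ xs (f≡0 ∘ there))

triangleSum : ℕ → (ℕ → ℕ → ℕ) → ℕ
triangleSum n f = sum (map (λ i → sum (map (f i) (range (suc i) (n ∸ 1)))) (range 1 (n ∸ 2)))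

module _ (n : ℕ) {f g : ℕ → ℕ → ℕ} where

  private
    rows : List ℕ
    rows = range 1 (n ∸ 2)

    columns : ℕ → List ℕ
    columns i = range (suc i) (n ∸ 1)

  triangleSum-mono : (∀ i j → f i j ≤ g i j) → triangleSum n f ≤ triangleSum n g
  triangleSum-mono f≤g = sum-map-mono (λ i → sum-map-mono (f≤g i) (columns i)) rows

  triangleSum-cong : (∀ {i j} → 1 ≤ i → i < j → j ≤ n ∸ 1 → f i j ≡ g i j) →
    triangleSum n f ≡ triangleSum n g
  triangleSum-cong f≡g = sum-map-cong {xs = rows} λ i∈ → sum-map-cong {xs = columns _} λ j∈ →
    f≡g (proj₁ (∈-range⁻ i∈)) (proj₁ (∈-range⁻ j∈)) (proj₂ (∈-range⁻ j∈))

  triangleSum-≡⇒ : (∀ i j → f i j ≤ g i j) → triangleSum n f ≡ triangleSum n g →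
    ∀ {i j} → 1 ≤ i → i ≤ n ∸ 2 → i < j → j ≤ n ∸ 1 → f i j ≡ g i j
  triangleSum-≡⇒ f≤g eq 1≤i i≤n-2 i<j j≤n-1 =
    sum-map-≡⇒ (f≤g _) (sum-map-≡⇒ (λ i → sum-map-mono (f≤g i) (columns i)) {rows} eq (∈-range⁺ 1≤i i≤n-2))
      (∈-range⁺ i<j j≤n-1)

-- twice the paper's |H_{i,j} − (j−i+1)/2|
windowGap : List Bool → ℕ → ℕ → ℕ
windowGap p i j = ∣ Hij p i j + Hij p i j - suc (j ∸ i) ∣

windowParity : ℕ → ℕ → ℕ
windowParity i j = suc (j ∸ i) % 2

gapSum : ℕ → List Bool → ℕ
gapSum n p = triangleSum n (windowGap p)

minimalGapSum : ℕ → ℕ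
minimalGapSum n = triangleSum n windowParity

windowParity≤windowGap : ∀ p i j → windowParity i j ≤ windowGap p i j
windowParity≤windowGap p i j = %2≤∣h+h-m∣ (Hij p i j) (suc (j ∸ i))

minimalGapSum≤gapSum : ∀ n p → minimalGapSum n ≤ gapSum n p
minimalGapSum≤gapSum n p = triangleSum-mono n (windowParity≤windowGap p)

Alternating⇒windowGap≡windowParity : ∀ {p} → Alternating p →
  ∀ {i j} → 1 ≤ i → i ≤ j → j ≤ length p → windowGap p i j ≡ windowParity i j
Alternating⇒windowGap≡windowParity {p} a {i} {j} 1≤i i≤j j≤len =
  subst (λ l → ∣ Hij p i j + Hij p i j - l ∣ ≡ l % 2) (length-window p 1≤i i≤j j≤len)
    (Alternating⇒∣2countH-length∣≡length%2 (window p i j) (Alternating-take _ _ (Alternating-drop (i ∸ 1) p a)))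

windowGap≡windowParity⇒pairBalanced : ∀ p k → windowGap p (suc k) (2 + k) ≡ windowParity (suc k) (2 + k) →
  countH (take 2 (drop k p)) + countH (take 2 (drop k p)) ≡ 2
windowGap≡windowParity⇒pairBalanced p k eq rewrite m+n∸n≡m 1 k = ∣m-n∣≡0⇒m≡n eq

gapSum≡minimalGapSum⇔Alternating : ∀ N p → length p ≡ suc N →
  gapSum (2 + N) p ≡ minimalGapSum (2 + N) ⇔ Alternating p
gapSum≡minimalGapSum⇔Alternating N p len = mk⇔ to from
  where
  to : gapSum (2 + N) p ≡ minimalGapSum (2 + N) → Alternating p
  to eq = Alternating-fromPairs p λ k 2+k≤len →
    let 2+k≤1+N = subst (2 + k ≤_) len 2+k≤len in
    windowGap≡windowParity⇒pairBalanced p k (sym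
      (triangleSum-≡⇒ (2 + N) (windowParity≤windowGap p) (sym eq) (s≤s z≤n) (s≤s⁻¹ 2+k≤1+N) ≤-refl 2+k≤1+N))

  from : Alternating p → gapSum (2 + N) p ≡ minimalGapSum (2 + N)
  from a = triangleSum-cong (2 + N) λ 1≤i i<j j≤1+N →
    Alternating⇒windowGap≡windowParity a 1≤i (<⇒≤ i<j) (subst (_ ≤_) (sym len) j≤1+N)

applyUpTo-cong : ∀ {A : Set} {f g : ℕ → A} → (∀ k → f k ≡ g k) → ∀ n → applyUpTo f n ≡ applyUpTo g n
applyUpTo-cong f≗g zero    = refl
applyUpTo-cong f≗g (suc n) = cong₂ _∷_ (f≗g 0) (applyUpTo-cong (f≗g ∘ suc) n)

-- (2 + k) % 2 reduces to k % 2, so the step case is definitional.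
sum-applyUpTo-%2 : ∀ M → sum (applyUpTo (_% 2) M) ≡ ⌊ M /2⌋
sum-applyUpTo-%2 zero          = refl
sum-applyUpTo-%2 (suc zero)    = refl
sum-applyUpTo-%2 (suc (suc M)) = cong suc (sum-applyUpTo-%2 M)

windowParity-shift : ∀ i l → windowParity i (suc i + l) ≡ l % 2
windowParity-shift i l = cong (λ d → suc d % 2) (trans (cong (_∸ i) (sym (+-suc i l))) (m+n∸m≡n i (suc l)))

rowParitySum : ∀ i b → sum (map (windowParity i) (range (suc i) b)) ≡ ⌊ (b ∸ i) /2⌋
rowParitySum i b = begin
  sum (map (windowParity i) (applyUpTo (λ k → suc i + k) (b ∸ i)))
    ≡⟨ cong sum (map-applyUpTo _ _ (b ∸ i)) ⟩
  sum (applyUpTo (λ k → windowParity i (suc i + k)) (b ∸ i))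
    ≡⟨ cong sum (applyUpTo-cong (windowParity-shift i) (b ∸ i)) ⟩
  sum (applyUpTo (_% 2) (b ∸ i))
    ≡⟨ sum-applyUpTo-%2 (b ∸ i) ⟩
  ⌊ (b ∸ i) /2⌋
    ∎
  where open ≡-Reasoning

halvesSum : ℕ → ℕ
halvesSum N = sum (applyUpTo (λ k → ⌊ (N ∸ k) /2⌋) N)

halvesSum-double : ∀ m → halvesSum (m + m) ≡ m * m
halvesSum-double zero    = refl
halvesSum-double (suc m) = begin
  halvesSum (suc m + suc m)
    ≡⟨ cong (halvesSum ∘ suc) (+-suc m m) ⟩
  ⌊ 2 + (m + m) /2⌋ + (⌊ 1 + (m + m) /2⌋ + halvesSum (m + m))
    ≡⟨ cong₂ (λ a b → suc a + (b + halvesSum (m + m))) (sym (n≡⌊n+n/2⌋ m)) (sym (n≡⌈n+n/2⌉ m)) ⟩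
  suc m + (m + halvesSum (m + m))
    ≡⟨ cong (λ s → suc m + (m + s)) (halvesSum-double m) ⟩
  suc m + (m + m * m)
    ≡⟨ cong (λ k → suc m + k) (sym (*-suc m m)) ⟩
  suc m * suc m
    ∎
  where open ≡-Reasoning

minimalGapSum-even : ∀ m → minimalGapSum (2 + (m + m)) ≡ m * m
minimalGapSum-even m = begin
  sum (map (λ i → sum (map (windowParity i) (range (suc i) (suc N)))) (applyUpTo suc N))
    ≡⟨ cong sum (map-cong (λ i → rowParitySum i (suc N)) (applyUpTo suc N)) ⟩
  sum (map (λ i → ⌊ (suc N ∸ i) /2⌋) (applyUpTo suc N))  ≡⟨ cong sum (map-applyUpTo suc _ N) ⟩
  halvesSum N                                            ≡⟨ halvesSum-double m ⟩
  m * m                                                  ∎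
  where
  N : ℕ
  N = m + m
  open ≡-Reasoning

half : ℕ → ℚ
half k = + k / 2

toℚᵘ-half : ∀ k → toℚᵘ (half k) ℚᵘ.≃ mkℚᵘ (+ k) 1
toℚᵘ-half k = ℚ.toℚᵘ-fromℚᵘ (mkℚᵘ (+ k) 1)

half-+ : ∀ a b → half (a + b) ≡ half a ℚ.+ half b
half-+ a b = ℚ.toℚᵘ-injective (begin
  toℚᵘ (half (a + b))                ≈⟨ toℚᵘ-half (a + b) ⟩
  mkℚᵘ (+ (a + b)) 1                 ≈⟨ *≡* (trans (cong (ℤ._* + 4) (ℤ.pos-+ a b)) (double-sum (+ a) (+ b))) ⟩
  mkℚᵘ (+ a) 1 ℚᵘ.+ mkℚᵘ (+ b) 1     ≈⟨ ℚᵘ.+-cong (ℚᵘ.≃-sym (toℚᵘ-half a)) (ℚᵘ.≃-sym (toℚᵘ-half b)) ⟩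
  toℚᵘ (half a) ℚᵘ.+ toℚᵘ (half b)   ≈⟨ ℚᵘ.≃-sym (ℚ.toℚᵘ-homo-+ (half a) (half b)) ⟩
  toℚᵘ (half a ℚ.+ half b)           ∎)
  where
  open ℚᵘ.≃-Reasoning
  double-sum : ∀ x y → (x ℤ.+ y) ℤ.* + 4 ≡ (x ℤ.* + 2 ℤ.+ y ℤ.* + 2) ℤ.* + 2
  double-sum = ℤ-Solver.solve-∀

∣m⊖n∣≡∣m-n∣ : ∀ m n → ℤ.∣ m ⊖ n ∣ ≡ ∣ m - n ∣
∣m⊖n∣≡∣m-n∣ zero    zero    = refl
∣m⊖n∣≡∣m-n∣ zero    (suc n) = refl
∣m⊖n∣≡∣m-n∣ (suc m) zero    = refl
∣m⊖n∣≡∣m-n∣ (suc m) (suc n) = trans (cong ℤ.∣_∣ (ℤ.[1+m]⊖[1+n]≡m⊖n m n)) (∣m⊖n∣≡∣m-n∣ m n)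

∣h*2-l*1∣≡∣h+h-l∣ : ∀ h l → ℤ.∣ + h ℤ.* + 2 ℤ.+ ℤ.- (+ l) ℤ.* + 1 ∣ ≡ ∣ h + h - l ∣
∣h*2-l*1∣≡∣h+h-l∣ h l = begin
  ℤ.∣ + h ℤ.* + 2 ℤ.+ ℤ.- (+ l) ℤ.* + 1 ∣   ≡⟨ cong ℤ.∣_∣ (rearrange (+ h) (+ l)) ⟩
  ℤ.∣ (+ h ℤ.+ + h) ℤ.- + l ∣               ≡⟨ cong (λ a → ℤ.∣ a ℤ.- + l ∣) (sym (ℤ.pos-+ h h)) ⟩
  ℤ.∣ + (h + h) ℤ.- + l ∣                   ≡⟨ cong ℤ.∣_∣ (ℤ.m-n≡m⊖n (h + h) l) ⟩
  ℤ.∣ (h + h) ⊖ l ∣                         ≡⟨ ∣m⊖n∣≡∣m-n∣ (h + h) l ⟩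
  ∣ h + h - l ∣                             ∎
  where
  open ≡-Reasoning
  rearrange : ∀ a b → a ℤ.* + 2 ℤ.+ ℤ.- b ℤ.* + 1 ≡ (a ℤ.+ a) ℤ.- b
  rearrange = ℤ-Solver.solve-∀

∣h-l/2∣≡half∣h+h-l∣ : ∀ h l → ℚ.∣ (+ h / 1) ℚ.- (+ l / 2) ∣ ≡ half ∣ h + h - l ∣
∣h-l/2∣≡half∣h+h-l∣ h l = ℚ.toℚᵘ-injective (begin
  toℚᵘ ℚ.∣ x ℚ.- y ∣
    ≈⟨ ℚ.toℚᵘ-homo-∣-∣ (x ℚ.- y) ⟩
  ℚᵘ.∣ toℚᵘ (x ℚ.- y) ∣
    ≈⟨ ℚᵘ.∣-∣-cong (ℚ.toℚᵘ-homo-+ x (ℚ.- y)) ⟩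
  ℚᵘ.∣ toℚᵘ x ℚᵘ.+ toℚᵘ (ℚ.- y) ∣
    ≈⟨ ℚᵘ.∣-∣-cong (ℚᵘ.+-cong (ℚ.toℚᵘ-fromℚᵘ (mkℚᵘ (+ h) 0))
                              (ℚᵘ.≃-trans (ℚ.toℚᵘ-homo‿- y) (ℚᵘ.-‿cong (toℚᵘ-half l)))) ⟩
  ℚᵘ.∣ mkℚᵘ (+ h) 0 ℚᵘ.- mkℚᵘ (+ l) 1 ∣
    ≈⟨ *≡* (cong (λ k → + k ℤ.* + 2) (∣h*2-l*1∣≡∣h+h-l∣ h l)) ⟩
  mkℚᵘ (+ ∣ h + h - l ∣) 1
    ≈⟨ ℚᵘ.≃-sym (toℚᵘ-half ∣ h + h - l ∣) ⟩
  toℚᵘ (half ∣ h + h - l ∣)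
    ∎)
  where
  open ℚᵘ.≃-Reasoning
  x y : ℚ
  x = + h / 1
  y = + l / 2

sumℚ-map-half : ∀ {A : Set} (f : A → ℕ) xs → sumℚ (map (half ∘ f) xs) ≡ half (sum (map f xs))
sumℚ-map-half f []       = refl
sumℚ-map-half f (x ∷ xs) = trans (cong (half (f x) ℚ.+_) (sumℚ-map-half f xs)) (sym (half-+ (f x) _))

sumℚ-map-*ʳ : ∀ {A : Set} (f : A → ℚ) c xs → sumℚ (map (λ x → f x ℚ.* c) xs) ≡ sumℚ (map f xs) ℚ.* c
sumℚ-map-*ʳ f c []       = sym (ℚ.*-zeroˡ c)
sumℚ-map-*ʳ f c (x ∷ xs) =
  trans (cong (f x ℚ.* c ℚ.+_) (sumℚ-map-*ʳ f c xs)) (sym (ℚ.*-distribʳ-+ c (f x) (sumℚ (map f xs))))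

half-∸ : ∀ {a b} → b ≤ a → half a ℚ.- half b ≡ half (a ∸ b)
half-∸ {a} {b} b≤a = begin
  half a ℚ.- half b                  ≡⟨ cong (λ c → half c ℚ.- half b) (sym (m+[n∸m]≡n b≤a)) ⟩
  half (b + (a ∸ b)) ℚ.- half b      ≡⟨ cong (ℚ._- half b) (half-+ b (a ∸ b)) ⟩
  half b ℚ.+ half (a ∸ b) ℚ.- half b ≡⟨ xyx⁻¹≈y (half b) (half (a ∸ b)) ⟩
  half (a ∸ b)                       ∎
  where open ≡-Reasoning

Delta≡half-gapSum : ∀ n p → Delta n p ≡ half (gapSum n p)
Delta≡half-gapSum n p = begin
  Delta n p                                    ≡⟨ cong sumℚ (map-cong rowDelta (range 1 (n ∸ 2))) ⟩
  sumℚ (map (half ∘ rowGap) (range 1 (n ∸ 2))) ≡⟨ sumℚ-map-half rowGap (range 1 (n ∸ 2)) ⟩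
  half (gapSum n p)                            ∎
  where
  open ≡-Reasoning
  columns : ℕ → List ℕ
  columns i = range (suc i) (n ∸ 1)
  rowGap : ℕ → ℕ
  rowGap i = sum (map (windowGap p i) (columns i))
  rowDelta : ∀ i → sumℚ (map (λ j → ℚ.∣ (+ Hij p i j / 1) ℚ.- (+ suc (j ∸ i) / 2) ∣) (columns i))
                   ≡ half (rowGap i)
  rowDelta i = trans (cong sumℚ (map-cong (λ j → ∣h-l/2∣≡half∣h+h-l∣ (Hij p i j) (suc (j ∸ i))) (columns i)))
                     (sumℚ-map-half (windowGap p i) (columns i))

half[m*m]≡[m+m]²/8 : ∀ m → half (m * m) ≡ + ((m + m) ^ 2) / 8
half[m*m]≡[m+m]²/8 m = ℚ.fromℚᵘ-cong {mkℚᵘ (+ (m * m)) 1} {mkℚᵘ (+ ((m + m) ^ 2)) 7} (*≡* (begin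
  + (m * m) ℤ.* + 8      ≡⟨ ℤ.pos-* (m * m) 8 ⟨
  + (m * m * 8)          ≡⟨ cong +_ (quadruple m) ⟩
  + ((m + m) ^ 2 * 2)    ≡⟨ ℤ.pos-* ((m + m) ^ 2) 2 ⟩
  + ((m + m) ^ 2) ℤ.* + 2 ∎))
  where
  open ≡-Reasoning
  quadruple : ∀ m → m * m * 8 ≡ (m + m) * ((m + m) * 1) * 2
  quadruple = ℕ-Solver.solve-∀

Delta-offset : ∀ m p → Delta (2 + (m + m)) p ℚ.- (+ ((m + m) ^ 2) / 8)
                       ≡ half (gapSum (2 + (m + m)) p ∸ minimalGapSum (2 + (m + m)))
Delta-offset m p = begin
  Delta n p ℚ.- (+ ((m + m) ^ 2) / 8)
    ≡⟨ cong₂ ℚ._-_ (Delta≡half-gapSum n p) (sym (half[m*m]≡[m+m]²/8 m)) ⟩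
  half (gapSum n p) ℚ.- half (m * m)
    ≡⟨ cong (λ c → half (gapSum n p) ℚ.- half c) (sym (minimalGapSum-even m)) ⟩
  half (gapSum n p) ℚ.- half (minimalGapSum n)
    ≡⟨ half-∸ (minimalGapSum≤gapSum n p) ⟩
  half (gapSum n p ∸ minimalGapSum n)
    ∎
  where
  n : ℕ
  n = 2 + (m + m)
  open ≡-Reasoning

module _ {A : Set} (_≟_ : DecidableEquality A) where

  length-filter-≢ : ∀ {xs t} → Unique xs → t ∈ xs → length (filter (λ s → ¬? (s ≟ t)) xs) ≡ length xs ∸ 1
  length-filter-≢ {x ∷ xs} (x∉xs ∷ _) (here refl) =
    trans (cong length (filter-reject (λ s → ¬? (s ≟ x)) (λ x≢x → x≢x refl)))
          (cong length (filter-all (λ s → ¬? (s ≟ x)) (All.map (λ x≢s s≡x → x≢s (sym s≡x)) x∉xs)))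
  length-filter-≢ {x ∷ xs@(_ ∷ _)} (x∉xs ∷ unique) (there t∈xs) =
    trans (cong length (filter-accept (λ s → ¬? (s ≟ _)) (λ x≡t → All.lookup x∉xs t∈xs x≡t)))
          (cong suc (length-filter-≢ unique t∈xs))

length-rankingHAP : ∀ {n} (S : Schedule n) t → length (rankingHAP S t) ≡ n ∸ 1
length-rankingHAP {n} S t = begin
  length (rankingHAP S t)   ≡⟨ length-map (home S t) (opponents t) ⟩
  length (opponents t)      ≡⟨ length-filter-≢ Fin._≟_ (allFin⁺ n) (∈-allFin t) ⟩
  length (allFin n) ∸ 1     ≡⟨ cong (_∸ 1) (length-tabulate {n = n} id) ⟩
  n ∸ 1                     ∎
  where open ≡-Reasoning

excess : ∀ {n} → Schedule n → Fin n → ℕ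
excess {n} S t = gapSum n (rankingHAP S t) ∸ minimalGapSum n

totalExcess : ∀ {n} → Schedule n → ℕ
totalExcess {n} S = sum (map (excess S) (allFin n))

teamScale : ℕ → ℚ
teamScale n = (+ 24 / 1) ℚ.* inv (n * (n ∸ 1) * (n ∸ 2))

scale : ℕ → ℚ
scale n = teamScale n ℚ.* inv n

Fteam≡half-excess : ∀ m (S : Schedule (2 + (m + m))) t → Fteam S t ≡ half (excess S t) ℚ.* teamScale (2 + (m + m))
Fteam≡half-excess m S t =
  trans (cong (λ x → (x ℚ.* (+ 24 / 1)) ℚ.* inv (n * (n ∸ 1) * (n ∸ 2))) (Delta-offset m (rankingHAP S t)))
        (ℚ.*-assoc (half (excess S t)) (+ 24 / 1) (inv (n * (n ∸ 1) * (n ∸ 2))))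
  where
  n : ℕ
  n = 2 + (m + m)

rankingFairness≡half-totalExcess : ∀ m (S : Schedule (2 + (m + m))) →
  rankingFairness S ≡ half (totalExcess S) ℚ.* scale (2 + (m + m))
rankingFairness≡half-totalExcess m S = begin
  sumℚ (map (Fteam S) teams) ℚ.* inv n
    ≡⟨ cong (λ x → sumℚ x ℚ.* inv n) (map-cong (Fteam≡half-excess m S) teams) ⟩
  sumℚ (map (λ t → half (excess S t) ℚ.* teamScale n) teams) ℚ.* inv n
    ≡⟨ cong (ℚ._* inv n) (sumℚ-map-*ʳ (half ∘ excess S) (teamScale n) teams) ⟩
  (sumℚ (map (half ∘ excess S) teams) ℚ.* teamScale n) ℚ.* inv n
    ≡⟨ cong (λ x → (x ℚ.* teamScale n) ℚ.* inv n) (sumℚ-map-half (excess S) teams) ⟩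
  (half (totalExcess S) ℚ.* teamScale n) ℚ.* inv n
    ≡⟨ ℚ.*-assoc (half (totalExcess S)) (teamScale n) (inv n) ⟩
  half (totalExcess S) ℚ.* scale n
    ∎
  where
  open ≡-Reasoning
  n : ℕ
  n = 2 + (m + m)
  teams : List (Fin n)
  teams = allFin n

inv-positive : ∀ k .{{_ : NonZero k}} → Positive (inv k)
inv-positive (suc k) = ℚ.normalize-pos 1 (suc k)

scale-positive : ∀ m → Positive (scale (2 + (suc m + suc m)))
scale-positive m = ℚ.pos*pos⇒pos (teamScale n) {{teamScale-positive}} (inv n) {{inv-positive n}}
  where
  n : ℕ
  n = 2 + (suc m + suc m)
  teamScale-positive : Positive (teamScale n)
  teamScale-positive = ℚ.pos*pos⇒pos (+ 24 / 1) {{ℚ.normalize-pos 24 1}}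
    (inv (n * (n ∸ 1) * (n ∸ 2))) {{inv-positive (n * (n ∸ 1) * (n ∸ 2))}}

half-*-positive≡0⇔ : ∀ e c → .{{Positive c}} → half e ℚ.* c ≡ 0ℚ ⇔ e ≡ 0
half-*-positive≡0⇔ e c = mk⇔ (to e) (λ { refl → ℚ.*-zeroˡ c })
  where
  to : ∀ e → half e ℚ.* c ≡ 0ℚ → e ≡ 0
  to zero    _  = refl
  to (suc e) eq = ⊥-elim (ℚ.<-irrefl (sym eq) (ℚ.positive⁻¹ _ {{half[1+e]*c-positive}}))
    where
    half[1+e]*c-positive : Positive (half (suc e) ℚ.* c)
    half[1+e]*c-positive = ℚ.pos*pos⇒pos (half (suc e)) {{ℚ.normalize-pos (suc e) 2}} c

rankingFairness≡0⇔noExcess : ∀ m (S : Schedule (2 + (suc m + suc m))) →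
  rankingFairness S ≡ 0ℚ ⇔ (∀ t → excess S t ≡ 0)
rankingFairness≡0⇔noExcess m S = mk⇔
  (λ F≡0 t → sum-map-≡0⇒ (excess S) (to (trans (sym F≡) F≡0)) (∈-allFin t))
  (λ noExcess → trans F≡ (from (sum-map-≡0⇐ (excess S) (allFin _) (λ {t} _ → noExcess t))))
  where
  open Equivalence (half-*-positive≡0⇔ (totalExcess S) (scale (2 + (suc m + suc m))) {{scale-positive m}})
  F≡ : rankingFairness S ≡ half (totalExcess S) ℚ.* scale (2 + (suc m + suc m))
  F≡ = rankingFairness≡half-totalExcess (suc m) S

excess≡0⇔Alternating : ∀ {N} (S : Schedule (2 + N)) t → excess S t ≡ 0 ⇔ Alternating (rankingHAP S t)
excess≡0⇔Alternating {N} S t = mk⇔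
  (λ e≡0 → to (≤-antisym (m∸n≡0⇒m≤n e≡0) (minimalGapSum≤gapSum (2 + N) p)))
  (λ a → trans (cong (_∸ minimalGapSum (2 + N)) (from a)) (n∸n≡0 (minimalGapSum (2 + N))))
  where
  p : List Bool
  p = rankingHAP S t
  open Equivalence (gapSum≡minimalGapSum⇔Alternating N p (length-rankingHAP S t))

even≥4-shape : ∀ {n} → 4 ≤ n → 2 ∣ n → ∃ λ m → n ≡ 2 + (suc m + suc m)
even≥4-shape (s≤s (s≤s ())) (divides 1 refl)
even≥4-shape _              (divides (suc (suc m)) refl) = m , double m
  where
  double : ∀ m → (2 + m) * 2 ≡ 2 + ((1 + m) + (1 + m))
  double = ℕ-Solver.solve-∀

lemma2 : (n : ℕ) → 4 ≤ n → 2 ∣ n → (S : Schedule n) →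
    (rankingFairness S ≡ 0ℚ) ⇔ RankingFair S
lemma2 n 4≤n 2∣n S with m , refl ← even≥4-shape 4≤n 2∣n = mk⇔
  (λ F≡0 t → to (excess≡0⇔Alternating S t) (to (rankingFairness≡0⇔noExcess m S) F≡0 t))
  (λ fair → from (rankingFairness≡0⇔noExcess m S) (λ t → from (excess≡0⇔Alternating S t) (fair t)))
  where open Equivalence
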